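{- For any index $\mathbf{k}$, the element $w^{\mathcal{S},\ast}_{\hbar}(g_{\mathbf{k}})$ belongs to the $\mathbb{Z}$-submodule $\bigoplus_{\mathbf{l}}\mathbb{Z}\,g_{\mathbf{l}}$, where $\mathbf{l}$ runs over admissible indices.
   Context: Let $\mathcal{C}=\mathbb{Q}[\hbar]$, $\mathfrak{H}=\mathcal{C}\langle a,b\rangle$ (non-commutative). For $k\ge1$, $g_{k}=ba^{k}$, $e_{k}=b(a+\hbar)a^{k-1}$ (so $e_1-g_1=\hbar b$). $A=\{\hbar b\}\cup\{ba^{k}\mid k\ge1\}$, $\mathcal{C}\langle A\rangle$ the $\mathcal{C}$-subalgebra generated by $1$ and $A$, $\mathfrak{z}$ the $\mathcal{C}$-span of $A$. An index is a finite (possibly empty) tuple $\mathbf{k}=(k_1,\dots,k_r)$ of positive integers; it is admissible if empty or $k_r\ge2$; $g_{\mathbf{k}}=g_{k_1}\cdots g_{k_r}$, $g_\varnothing=1$. Harmonic product: $\circ_\hbar:\mathfrak{z}\times\mathfrak{z}\to\mathfrak{z}$ symmetric $\mathcal{C}$-bilinear with $(e_1-g_1)\circ_\hbar(e_1-g_1)=\hbar(e_1-g_1)$, $(e_1-g_1)\circ_\hbar g_k=\hbar g_k$, $g_k\circ_\hbar g_l=g_{k+l}$; $\ast_\hbar$ is the $\mathcal{C}$-bilinear product on $\mathcal{C}\langle A\rangle$ with $w\ast_\hbar1=1\ast_\hbar w=w$, $(wu)\ast_\hbar(w'v)=(w\ast_\hbar w'v)u+(wu\ast_\hbar w')v+(w\ast_\hbar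 w')(u\circ_\hbar v)$ for $u,v\in A$. $\psi^\ast$ is the $\mathcal{C}$-algebra anti-automorphism of $\mathcal{C}\langle A\rangle$ with $\psi^\ast(\hbar b)=\hbar b$, $\psi^\ast(ba^k)=b(-a)^k$. $w^{\mathcal{S},\ast}_\hbar$ is $\mathcal{C}$-linear on $\mathcal{C}\langle A\rangle$ with $w^{\mathcal{S},\ast}_\hbar(1)=1$, $w^{\mathcal{S},\ast}_\hbar(u_1\cdots u_r)=\sum_{i=0}^r(u_1\cdots u_i)\ast_\hbar\psi^\ast(u_{i+1}\cdots u_r)$ for $u_j\in A$. -}

module Defs where

open import Data.Nat as ℕ using (ℕ; zero; suc; _≤_)
open import Data.Integer as ℤ using (ℤ)
open import Data.Rational as ℚ using (ℚ; 0ℚ; 1ℚ; _+_; _*_; -_; _/_)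
open import Data.List using (List; []; _∷_; _++_; map; foldr; reverse; replicate; concat; take; drop; length; upTo; concatMap; last)
open import Data.List.Properties using (≡-dec)
open import Data.List.Relation.Unary.All using (All)
open import Data.Maybe using (Maybe; just; nothing)
open import Data.Product using (_×_; _,_)
open import Relation.Binary.PropositionalEquality using (_≡_; refl)
open import Relation.Nullary using (yes; no)
open import Data.Unit using (⊤)
open import Data.Empty using (⊥)

data Letter : Set where
  a b : Letter

_≟L_ : (x y : Letter) → Relation.Nullary.Dec (x ≡ y)
a ≟L a = yes refl
a ≟L b = no λ ()
b ≟L a = no λ ()
b ≟L b = yes refl

Word : Set
Word = List Letter

-- an element of H is a finite formal sum of terms  q · ħ^n · w
-- (q ∈ ℚ, n ∈ ℕ, w a word in a,b)
H : Set
H = List (ℚ × ℕ × Word)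

coeff : H → ℕ → Word → ℚ
coeff [] n w = 0ℚ
coeff ((q , m , v) ∷ xs) n w with m ℕ.≟ n | ≡-dec _≟L_ v w
... | yes _ | yes _ = q + coeff xs n w
... | _     | _     = coeff xs n w

infix 4 _≈H_
_≈H_ : H → H → Set
x ≈H y = ∀ n w → coeff x n w ≡ coeff y n w

-- hb stands for ħb,  g k stands for g_k = b a^k
data ALetter : Set where
  hb : ALetter
  g  : ℕ → ALetter

AWord : Set
AWord = List ALetter

-- elements of C⟨A⟩ written as formal sums  q · ħ^n · (u₁⋯u_r),  u_i ∈ A
CA : Set
CA = List (ℚ × ℕ × AWord)

ιL : ALetter → ℕ × Word
ιL hb    = 1 , (b ∷ [])
ιL (g k) = 0 , (b ∷ replicate k a)

ιW : AWord → ℕ × Word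
ιW [] = 0 , []
ιW (u ∷ us) with ιL u | ιW us
... | (m , v) | (n , w) = (m ℕ.+ n) , (v ++ w)

ι : CA → H
ι = map λ { (q , n , w) → let (m , v) = ιW w in (q , n ℕ.+ m , v) }

scale : ℚ → ℕ → CA → CA
scale q n = map λ { (p , m , w) → (q * p , n ℕ.+ m , w) }

-- harmonic product ∘ħ on letters:  u ∘ v = ħ^e · letter

circ : ALetter → ALetter → ℕ × ALetter
circ hb    hb    = 1 , hb
circ hb    (g k) = 1 , g k
circ (g k) hb    = 1 , g k
circ (g k) (g l) = 0 , g (k ℕ.+ l)

-- ∗ħ on words (words stored reversed so the last letter is the head)

private
  snocAll : ALetter → CA → CA
  snocAll u = map λ { (q , n , w) → (q , n , u ∷ w) }

  circAll : ALetter → ALetter → CA → CA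
  circAll u v xs with circ u v
  ... | (e , c) = map (λ { (q , n , w) → (q , e ℕ.+ n , c ∷ w) }) xs

  starR : AWord → AWord → CA
  starR [] w' = (1ℚ , 0 , w') ∷ []
  starR (u ∷ w) [] = (1ℚ , 0 , u ∷ w) ∷ []
  starR (u ∷ w) (v ∷ w') =
    snocAll u (starR w (v ∷ w'))
    ++ snocAll v (starR (u ∷ w) w')
    ++ circAll u v (starR w w')

star : AWord → AWord → CA
star w w' = map (λ { (q , n , x) → (q , n , reverse x) }) (starR (reverse w) (reverse w'))

_∗ħ_ : CA → CA → CA
xs ∗ħ ys = concatMap (λ { (q , n , w) → concatMap (λ { (p , m , w') → scale (q * p) (n ℕ.+ m) (star w w') }) ys }) xs

-- ψ* : anti-automorphism, ψ*(ħb) = ħb, ψ*(b a^k) = b(-a)^k = (-1)^k b a^k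

signL : ALetter → ℚ
signL hb    = 1ℚ
signL (g zero) = 1ℚ
signL (g (suc zero)) = - 1ℚ
signL (g (suc (suc k))) = signL (g k)

signW : AWord → ℚ
signW [] = 1ℚ
signW (u ∷ us) = signL u * signW us

ψ* : CA → CA
ψ* = map λ { (q , n , w) → (q * signW w , n , reverse w) }

word : AWord → CA
word w = (1ℚ , 0 , w) ∷ []

wSW : AWord → CA
wSW w = concatMap (λ i → word (take i w) ∗ħ ψ* (word (drop i w))) (upTo (suc (length w)))

wS : CA → CA
wS = concatMap λ { (q , n , w) → scale q n (wSW w) }

IsIndex : List ℕ → Set
IsIndex = All (λ k → 1 ≤ k)

Admissible : List ℕ → Set
Admissible ks with last ks
... | nothing = IsIndex ks
... | just k  = IsIndex ks × (2 ≤ k)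

gIdx : List ℕ → CA
gIdx ks = word (map g ks)

zComb : List (ℤ × List ℕ) → H
zComb = concatMap λ { (c , l) → ι (scale (c / 1) 0 (gIdx l)) }

-- Write w^{S,∗}(g_𝐤) = Σ_{x y = g_𝐤} x ∗ ψ*(y) and sort its terms by whether the word ends in g₁.
-- Since a contraction g_k ∘ g_l = g_{k+l} (k, l ≥ 1) never produces g₁, a term of x ∗ ψ*(y) ending in
-- g₁ is either (x″ ∗ ψ*(y)) g₁ with x = x″ g₁, or (x ∗ ψ*(y′)) g₁ with y = g₁ y′. The second kind for
-- the split (x, g₁ y′) cancels the first kind for (x g₁, y′) because ψ*(g₁) = −g₁, so these terms
-- telescope away. Every remaining term is ±g_𝐥 with 𝐥 an index whose last entry is not 1.
module Submission where

open import Defs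
open import Data.Bool using (Bool; true; false; not; if_then_else_; T)
open import Data.Integer using (ℤ)
open import Data.Maybe using (just; nothing)
open import Data.List
  using (List; []; _∷_; _++_; _∷ʳ_; map; concat; concatMap; reverse; take; drop; length; upTo; applyUpTo; filterᵇ; last)
open import Data.List.Properties
  using (++-assoc; ++-identityʳ; map-++; map-injective; map-applyUpTo; map-cong-local; concatMap-map;
         reverse-involutive; reverse-++; unfold-reverse; filter-++; ≡-dec)
open import Data.List.Relation.Unary.All as All using (All; []; _∷_)
open import Data.List.Relation.Unary.All.Properties using (++⁺; map⁺; concat⁺; filter⁺)
open import Data.Nat as ℕ using (ℕ; zero; suc; _≤_; s≤s; z≤n)
open import Data.Nat.Properties using (+-suc)
open import Data.Product using (Σ; _×_; _,_; proj₁; proj₂; uncurry)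
open import Data.Rational using (ℚ; 0ℚ; 1ℚ; _+_; _*_; -_; _/_; ↥_)
import Data.Rational.Properties as ℚ
open import Data.Rational.Solver using (module +-*-Solver)
open import Data.Unit using (tt)
open import Function using (_∘_; id)
open import Relation.Binary.PropositionalEquality
open import Relation.Nullary using (yes; no)
open import Relation.Nullary.Decidable using (T?)
open ≡-Reasoning

Term : Set
Term = ℚ × ℕ × AWord

wordOf : Term → AWord
wordOf (_ , _ , u) = u

reverseTerm : Term → Term
reverseTerm (q , n , u) = q , n , reverse u

reverseTerm-involutive : ∀ t → reverseTerm (reverseTerm t) ≡ t
reverseTerm-involutive (q , n , u) = cong (λ v → q , n , v) (reverse-involutive u)

reverseTerm-injective : ∀ {s t} → reverseTerm s ≡ reverseTerm t → s ≡ t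
reverseTerm-injective {s} {t} e =
  trans (sym (reverseTerm-involutive s)) (trans (cong reverseTerm e) (reverseTerm-involutive t))

All-reverse : ∀ {A : Set} {P : A → Set} {xs} → All P xs → All P (reverse xs)
All-reverse [] = []
All-reverse {P = P} {x ∷ xs} (px ∷ pxs) =
  subst (All P) (sym (unfold-reverse x xs)) (++⁺ (All-reverse pxs) (px ∷ []))

applyUpTo-cong : ∀ {A : Set} {f f′ : ℕ → A} → (∀ i → f i ≡ f′ i) → ∀ n → applyUpTo f n ≡ applyUpTo f′ n
applyUpTo-cong f≗f′ zero = refl
applyUpTo-cong f≗f′ (suc n) = cong₂ _∷_ (f≗f′ 0) (applyUpTo-cong (f≗f′ ∘ suc) n)

filterᵇ-map : ∀ {A B : Set} {p : B → Bool} {q : A → Bool} (f : A → B) →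
  (∀ x → p (f x) ≡ q x) → ∀ xs → filterᵇ p (map f xs) ≡ map f (filterᵇ q xs)
filterᵇ-map f pf≗q [] = refl
filterᵇ-map {p = p} {q} f pf≗q (x ∷ xs) with p (f x) | q x | pf≗q x
... | true  | true  | refl = cong (f x ∷_) (filterᵇ-map f pf≗q xs)
... | false | false | refl = filterᵇ-map f pf≗q xs

filterᵇ-concatMap : ∀ {A B : Set} (p : B → Bool) (F : A → List B) xs →
  filterᵇ p (concatMap F xs) ≡ concatMap (filterᵇ p ∘ F) xs
filterᵇ-concatMap p F [] = refl
filterᵇ-concatMap p F (x ∷ xs) =
  trans (filter-++ (T? ∘ p) (F x) (concatMap F xs)) (cong (filterᵇ p (F x) ++_) (filterᵇ-concatMap p F xs))

-- The recursion defining ∗ħ, on reversed words (head = last letter).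

prepend : ALetter → CA → CA
prepend u = map λ { (q , n , w) → q , n , u ∷ w }

circRev : ALetter → ALetter → CA → CA
circRev u v = map λ { (q , n , w) → q , proj₁ (circ u v) ℕ.+ n , proj₂ (circ u v) ∷ w }

starRev : AWord → AWord → CA
starRev [] s = word s
starRev (u ∷ r) [] = word (u ∷ r)
starRev (u ∷ r) (v ∷ s) =
  prepend u (starRev r (v ∷ s)) ++ prepend v (starRev (u ∷ r) s) ++ circRev u v (starRev r s)

star-reverse : ∀ r s → star (reverse r) (reverse s) ≡ map reverseTerm (starRev r s)
star-reverse [] s rewrite reverse-involutive s = refl
star-reverse (u ∷ r) [] rewrite reverse-involutive (u ∷ r) = refl
star-reverse (u ∷ r) (v ∷ s) with star-reverse r (v ∷ s) | star-reverse (u ∷ r) s | star-reverse r s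
... | ih₁ | ih₂ | ih₃
  rewrite reverse-involutive (u ∷ r) | reverse-involutive (v ∷ s) | reverse-involutive r | reverse-involutive s =
  cong (map reverseTerm)
    (cong₂ _++_ (cong (prepend u) (unmap ih₁)) (cong₂ _++_ (cong (prepend v) (unmap ih₂)) (cong (circRev u v) (unmap ih₃))))
  where unmap = map-injective reverseTerm-injective

word-∗ħ-ψ* : ∀ x y → word x ∗ħ ψ* (word y) ≡ scale (signW y) 0 (map reverseTerm (starRev (reverse x) y))
word-∗ħ-ψ* x y = begin
  (scale (1ℚ * (1ℚ * signW y)) 0 (star x (reverse y)) ++ []) ++ []
    ≡⟨ trans (++-identityʳ (X ++ [])) (++-identityʳ X) ⟩
  X
    ≡⟨ cong₂ (λ q Y → scale q 0 Y) (trans (ℚ.*-identityˡ (1ℚ * signW y)) (ℚ.*-identityˡ (signW y))) star-x-reverse-y ⟩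
  scale (signW y) 0 (map reverseTerm (starRev (reverse x) y)) ∎
  where
  X = scale (1ℚ * (1ℚ * signW y)) 0 (star x (reverse y))
  star-x-reverse-y : star x (reverse y) ≡ map reverseTerm (starRev (reverse x) y)
  star-x-reverse-y = subst (λ z → star z (reverse y) ≡ map reverseTerm (starRev (reverse x) y))
    (reverse-involutive x) (star-reverse (reverse x) y)

splits : AWord → AWord → List (AWord × AWord)
splits p [] = (p , []) ∷ []
splits p (u ∷ y) = (p , u ∷ y) ∷ splits (p ∷ʳ u) y

applyUpTo-splits : ∀ p y → applyUpTo (λ i → p ++ take i y , drop i y) (suc (length y)) ≡ splits p y
applyUpTo-splits p [] = cong (λ p′ → (p′ , []) ∷ []) (++-identityʳ p)
applyUpTo-splits p (u ∷ y) = cong₂ _∷_ (cong (_, u ∷ y) (++-identityʳ p)) (begin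
  applyUpTo (λ i → p ++ u ∷ take i y , drop i y) (suc (length y))
    ≡⟨ applyUpTo-cong (λ i → cong (_, drop i y) (sym (++-assoc p (u ∷ []) (take i y)))) (suc (length y)) ⟩
  applyUpTo (λ i → (p ∷ʳ u) ++ take i y , drop i y) (suc (length y))
    ≡⟨ applyUpTo-splits (p ∷ʳ u) y ⟩
  splits (p ∷ʳ u) y ∎)

splits-All : ∀ {P : ALetter → Set} {p y} → All P p → All P y →
  All (uncurry λ x y → All P x × All P y) (splits p y)
splits-All pp [] = (pp , []) ∷ []
splits-All pp (pu ∷ py) = (pp , pu ∷ py) ∷ splits-All (++⁺ pp (pu ∷ [])) py

wSW-splits : ∀ w → wSW w ≡ concatMap (uncurry λ x y → word x ∗ħ ψ* (word y)) (splits [] w)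
wSW-splits w =
  trans (sym (concatMap-map F (λ i → take i w , drop i w) (upTo (suc (length w)))))
        (cong (concatMap F) (trans (map-applyUpTo id (λ i → take i w , drop i w) (suc (length w))) (applyUpTo-splits [] w)))
  where F = uncurry λ x y → word x ∗ħ ψ* (word y)

isG1 : ALetter → Bool
isG1 (g (suc zero)) = true
isG1 _ = false

startsWithG1 : AWord → Bool
startsWithG1 [] = false
startsWithG1 (u ∷ _) = isG1 u

endsInG1 : AWord → Bool
endsInG1 [] = false
endsInG1 (u ∷ []) = isG1 u
endsInG1 (_ ∷ v ∷ w) = endsInG1 (v ∷ w)

endsInG1-∷ʳ : ∀ w u → endsInG1 (w ∷ʳ u) ≡ isG1 u
endsInG1-∷ʳ [] u = refl
endsInG1-∷ʳ (_ ∷ []) u = refl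
endsInG1-∷ʳ (_ ∷ v ∷ w) u = endsInG1-∷ʳ (v ∷ w) u

endsInG1-reverse : ∀ w → endsInG1 (reverse w) ≡ startsWithG1 w
endsInG1-reverse [] = refl
endsInG1-reverse (u ∷ w) = trans (cong endsInG1 (unfold-reverse u w)) (endsInG1-∷ʳ (reverse w) u)

startingWithG1 endingInG1 notEndingInG1 : CA → CA
startingWithG1 = filterᵇ (startsWithG1 ∘ wordOf)
endingInG1 = filterᵇ (endsInG1 ∘ wordOf)
notEndingInG1 = filterᵇ (not ∘ endsInG1 ∘ wordOf)

data Positive : ALetter → Set where
  g-suc : ∀ k → Positive (g (suc k))

-- The terms of starRev r s with leading g₁, by whether that g₁ is the last letter of r or of s.
keepIfG1 : ALetter → CA → CA
keepIfG1 u X = if isG1 u then prepend u X else []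

fromLeft fromRight : AWord → AWord → CA
fromLeft [] s = []
fromLeft (u ∷ r) s = keepIfG1 u (starRev r s)
fromRight r [] = []
fromRight r (v ∷ s) = keepIfG1 v (starRev r s)

startingWithG1-prepend : ∀ u X → startingWithG1 (prepend u X) ≡ keepIfG1 u X
startingWithG1-prepend u [] with isG1 u
... | true = refl
... | false = refl
startingWithG1-prepend u (t ∷ X) with isG1 u | startingWithG1-prepend u X
... | true | ih = cong (_ ∷_) ih
... | false | ih = ih

startingWithG1-circRev : ∀ k l X → startingWithG1 (circRev (g (suc k)) (g (suc l)) X) ≡ []
startingWithG1-circRev k l [] = refl
startingWithG1-circRev k l (_ ∷ X) rewrite +-suc k l = startingWithG1-circRev k l X

startingWithG1-starRev : ∀ {r s} → All Positive r → All Positive s →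
  startingWithG1 (starRev r s) ≡ fromLeft r s ++ fromRight r s
startingWithG1-starRev {[]} {[]} _ _ = refl
startingWithG1-starRev {[]} {v ∷ s} _ _ = startingWithG1-prepend v (word s)
startingWithG1-starRev {u ∷ []} {[]} _ _ = trans (startingWithG1-prepend u _) (sym (++-identityʳ _))
startingWithG1-starRev {u ∷ _ ∷ _} {[]} _ _ = trans (startingWithG1-prepend u _) (sym (++-identityʳ _))
startingWithG1-starRev {u ∷ r} {v ∷ s} (g-suc k ∷ _) (g-suc l ∷ _) = begin
  startingWithG1 (prepend u A ++ prepend v B ++ circRev u v C)
    ≡⟨ filter-++ P? (prepend u A) (prepend v B ++ circRev u v C) ⟩
  startingWithG1 (prepend u A) ++ startingWithG1 (prepend v B ++ circRev u v C)
    ≡⟨ cong₂ _++_ (startingWithG1-prepend u A) (filter-++ P? (prepend v B) (circRev u v C)) ⟩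
  keepIfG1 u A ++ startingWithG1 (prepend v B) ++ startingWithG1 (circRev u v C)
    ≡⟨ cong (keepIfG1 u A ++_) (cong₂ _++_ (startingWithG1-prepend v B) (startingWithG1-circRev k l C)) ⟩
  keepIfG1 u A ++ keepIfG1 v B ++ []
    ≡⟨ cong (keepIfG1 u A ++_) (++-identityʳ (keepIfG1 v B)) ⟩
  keepIfG1 u A ++ keepIfG1 v B ∎
  where
  P? = T? ∘ startsWithG1 ∘ wordOf
  A = starRev r (v ∷ s)
  B = starRev (u ∷ r) s
  C = starRev r s

leftPart rightPart : AWord → AWord → CA
leftPart x y = scale (signW y) 0 (map reverseTerm (fromLeft (reverse x) y))
rightPart x y = scale (signW y) 0 (map reverseTerm (fromRight (reverse x) y))

endingInG1-split : ∀ {x y} → All Positive x → All Positive y →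
  endingInG1 (word x ∗ħ ψ* (word y)) ≡ leftPart x y ++ rightPart x y
endingInG1-split {x} {y} px py = begin
  endingInG1 (word x ∗ħ ψ* (word y))
    ≡⟨ cong endingInG1 (word-∗ħ-ψ* x y) ⟩
  endingInG1 (scale s 0 (map reverseTerm Z))
    ≡⟨ filterᵇ-map {p = endsInG1 ∘ wordOf} _ (λ _ → refl) (map reverseTerm Z) ⟩
  scale s 0 (endingInG1 (map reverseTerm Z))
    ≡⟨ cong (scale s 0) (filterᵇ-map reverseTerm (endsInG1-reverse ∘ wordOf) Z) ⟩
  scale s 0 (map reverseTerm (startingWithG1 Z))
    ≡⟨ cong (scale s 0 ∘ map reverseTerm) (startingWithG1-starRev (All-reverse px) py) ⟩
  scale s 0 (map reverseTerm (fromLeft (reverse x) y ++ fromRight (reverse x) y))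
    ≡⟨ trans (cong (scale s 0) (map-++ reverseTerm L R)) (map-++ _ (map reverseTerm L) (map reverseTerm R)) ⟩
  leftPart x y ++ rightPart x y ∎
  where
  s = signW y
  Z = starRev (reverse x) y
  L = fromLeft (reverse x) y
  R = fromRight (reverse x) y

coeff-++ : ∀ X Y n w → coeff (X ++ Y) n w ≡ coeff X n w + coeff Y n w
coeff-++ [] Y n w = sym (ℚ.+-identityˡ _)
coeff-++ ((q , m , v) ∷ X) Y n w with m ℕ.≟ n | ≡-dec _≟L_ v w
... | yes _ | yes _ = trans (cong (q +_) (coeff-++ X Y n w)) (sym (ℚ.+-assoc q _ _))
... | yes _ | no _ = coeff-++ X Y n w
... | no _ | _ = coeff-++ X Y n w

module AtMonomial (n : ℕ) (w : Word) where

  open +-*-Solver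

  φ : CA → ℚ
  φ X = coeff (ι X) n w

  φ-++ : ∀ X Y → φ (X ++ Y) ≡ φ X + φ Y
  φ-++ X Y = trans (cong (λ Z → coeff Z n w) (map-++ _ X Y)) (coeff-++ (ι X) (ι Y) n w)

  φ-scale : ∀ q X → φ (scale q 0 X) ≡ q * φ X
  φ-scale q [] = sym (ℚ.*-zeroʳ q)
  φ-scale q ((p , m , u) ∷ X) with (m ℕ.+ proj₁ (ιW u)) ℕ.≟ n | ≡-dec _≟L_ (proj₂ (ιW u)) w
  ... | yes _ | yes _ = trans (cong ((q * p) +_) (φ-scale q X)) (sym (ℚ.*-distribˡ-+ q p _))
  ... | yes _ | no _ = φ-scale q X
  ... | no _ | _ = φ-scale q X

  φ-partition : ∀ (p : Term → Bool) X → φ X ≡ φ (filterᵇ p X) + φ (filterᵇ (not ∘ p) X)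
  φ-partition p [] = refl
  φ-partition p (t ∷ X) with p t
  ... | true = begin
    φ (t ∷ X)                     ≡⟨ φ-++ (t ∷ []) X ⟩
    φ (t ∷ []) + φ X              ≡⟨ cong (φ (t ∷ []) +_) (φ-partition p X) ⟩
    φ (t ∷ []) + (φ Y + φ N)      ≡⟨ sym (ℚ.+-assoc (φ (t ∷ [])) (φ Y) (φ N)) ⟩
    (φ (t ∷ []) + φ Y) + φ N      ≡⟨ cong (_+ φ N) (sym (φ-++ (t ∷ []) Y)) ⟩
    φ (t ∷ Y) + φ N               ∎
    where Y = filterᵇ p X
          N = filterᵇ (not ∘ p) X
  ... | false = begin
    φ (t ∷ X)                     ≡⟨ φ-++ (t ∷ []) X ⟩
    φ (t ∷ []) + φ X              ≡⟨ cong (φ (t ∷ []) +_) (φ-partition p X) ⟩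
    φ (t ∷ []) + (φ Y + φ N)      ≡⟨ solve 3 (λ α β γ → α :+ (β :+ γ) := β :+ (α :+ γ)) refl (φ (t ∷ [])) (φ Y) (φ N) ⟩
    φ Y + (φ (t ∷ []) + φ N)      ≡⟨ cong (φ Y +_) (sym (φ-++ (t ∷ []) N)) ⟩
    φ Y + φ (t ∷ N)               ∎
    where Y = filterᵇ p X
          N = filterᵇ (not ∘ p) X

  telescope : (A B : AWord → AWord → CA) → (∀ x u y → φ (B x (u ∷ y)) + φ (A (x ∷ʳ u) y) ≡ 0ℚ) →
    ∀ p y → φ (concatMap (uncurry λ x y → A x y ++ B x y) (splits p y)) ≡ φ (A p y) + φ (B (p ++ y) [])
  telescope A B cancel p [] = begin
    φ ((A p [] ++ B p []) ++ [])  ≡⟨ cong φ (++-identityʳ (A p [] ++ B p [])) ⟩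
    φ (A p [] ++ B p [])          ≡⟨ φ-++ (A p []) (B p []) ⟩
    φ (A p []) + φ (B p [])       ≡⟨ cong (λ p′ → φ (A p []) + φ (B p′ [])) (sym (++-identityʳ p)) ⟩
    φ (A p []) + φ (B (p ++ []) []) ∎
  telescope A B cancel p (u ∷ y) = begin
    φ ((A p (u ∷ y) ++ B p (u ∷ y)) ++ rest)
      ≡⟨ φ-++ (A p (u ∷ y) ++ B p (u ∷ y)) rest ⟩
    φ (A p (u ∷ y) ++ B p (u ∷ y)) + φ rest
      ≡⟨ cong₂ _+_ (φ-++ (A p (u ∷ y)) (B p (u ∷ y))) (telescope A B cancel (p ∷ʳ u) y) ⟩
    (α + β) + (γ + δ)
      ≡⟨ solve 4 (λ α β γ δ → (α :+ β) :+ (γ :+ δ) := α :+ ((β :+ γ) :+ δ)) refl α β γ δ ⟩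
    α + ((β + γ) + δ)
      ≡⟨ cong (λ z → α + (z + δ)) (cancel p u y) ⟩
    α + (0ℚ + δ)
      ≡⟨ cong (α +_) (ℚ.+-identityˡ δ) ⟩
    α + δ
      ≡⟨ cong (λ p′ → α + φ (B p′ [])) (++-assoc p (u ∷ []) y) ⟩
    α + φ (B (p ++ u ∷ y) []) ∎
    where
    rest = concatMap (uncurry λ x y → A x y ++ B x y) (splits (p ∷ʳ u) y)
    α = φ (A p (u ∷ y))
    β = φ (B p (u ∷ y))
    γ = φ (A (p ∷ʳ u) y)
    δ = φ (B ((p ∷ʳ u) ++ y) [])

  φ-scale-neg : ∀ s X → φ (scale (signL (g 1) * s) 0 X) + φ (scale s 0 X) ≡ 0ℚ
  φ-scale-neg s X = begin
    φ (scale (- 1ℚ * s) 0 X) + φ (scale s 0 X)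
      ≡⟨ cong₂ _+_ (φ-scale (- 1ℚ * s) X) (φ-scale s X) ⟩
    (- 1ℚ * s) * φ X + s * φ X
      ≡⟨ solve 2 (λ s c → ((:- con 1ℚ) :* s) :* c :+ s :* c := con 0ℚ) refl s (φ X) ⟩
    0ℚ ∎

  rightPart-leftPart-cancel : ∀ x u y → φ (rightPart x (u ∷ y)) + φ (leftPart (x ∷ʳ u) y) ≡ 0ℚ
  rightPart-leftPart-cancel x u y =
    trans (cong (λ z → φ (rightPart x (u ∷ y)) + φ (scale (signW y) 0 (map reverseTerm (fromLeft z y))))
                (reverse-++ x (u ∷ [])))
          (cancel u)
    where
    M : ALetter → CA
    M u = map reverseTerm (keepIfG1 u (starRev (reverse x) y))
    cancel : ∀ u → φ (scale (signL u * signW y) 0 (M u)) + φ (scale (signW y) 0 (M u)) ≡ 0ℚ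
    cancel (g (suc zero)) = φ-scale-neg (signW y) (M (g 1))
    cancel hb = refl
    cancel (g zero) = refl
    cancel (g (suc (suc k))) = refl

  endingInG1-vanishes : ∀ {ws} → All Positive ws → φ (endingInG1 (wSW ws)) ≡ 0ℚ
  endingInG1-vanishes {ws} pws = begin
    φ (endingInG1 (wSW ws))
      ≡⟨ cong (φ ∘ endingInG1) (wSW-splits ws) ⟩
    φ (endingInG1 (concatMap F (splits [] ws)))
      ≡⟨ cong φ (filterᵇ-concatMap (endsInG1 ∘ wordOf) F (splits [] ws)) ⟩
    φ (concatMap (endingInG1 ∘ F) (splits [] ws))
      ≡⟨ cong (φ ∘ concat) (map-cong-local (All.map (uncurry endingInG1-split) (splits-All [] pws))) ⟩
    φ (concatMap (uncurry λ x y → leftPart x y ++ rightPart x y) (splits [] ws))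
      ≡⟨ telescope leftPart rightPart rightPart-leftPart-cancel [] ws ⟩
    0ℚ ∎
    where F = uncurry λ x y → word x ∗ħ ψ* (word y)

data IsSign : ℚ → Set where
  sign⁺ : IsSign 1ℚ
  sign⁻ : IsSign (- 1ℚ)

IsSign-* : ∀ {p q} → IsSign p → IsSign q → IsSign (p * q)
IsSign-* sign⁺ sign⁺ = sign⁺
IsSign-* sign⁺ sign⁻ = sign⁻
IsSign-* sign⁻ sign⁺ = sign⁻
IsSign-* sign⁻ sign⁻ = sign⁺

IsSign-signL : ∀ u → IsSign (signL u)
IsSign-signL hb = sign⁺
IsSign-signL (g zero) = sign⁺
IsSign-signL (g (suc zero)) = sign⁻
IsSign-signL (g (suc (suc k))) = IsSign-signL (g k)

IsSign-signW : ∀ w → IsSign (signW w)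
IsSign-signW [] = sign⁺
IsSign-signW (u ∷ w) = IsSign-* (IsSign-signL u) (IsSign-signW w)

SignedG : Term → Set
SignedG (q , n , u) = IsSign q × n ≡ 0 × All Positive u

starRev-SignedG : ∀ {r s} → All Positive r → All Positive s → All SignedG (starRev r s)
starRev-SignedG {[]} _ ps = (sign⁺ , refl , ps) ∷ []
starRev-SignedG {_ ∷ _} {[]} pr _ = (sign⁺ , refl , pr) ∷ []
starRev-SignedG {u ∷ r} {v ∷ s} (g-suc k ∷ pr) (g-suc l ∷ ps) =
  ++⁺ (prepend-SignedG (g-suc k) (starRev-SignedG pr (g-suc l ∷ ps)))
      (++⁺ (prepend-SignedG (g-suc l) (starRev-SignedG (g-suc k ∷ pr) ps))
           (map⁺ (All.map (λ { (σ , e , pw) → σ , e , g-suc (k ℕ.+ suc l) ∷ pw }) (starRev-SignedG pr ps))))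
  where
  prepend-SignedG : ∀ {u X} → Positive u → All SignedG X → All SignedG (prepend u X)
  prepend-SignedG pu = map⁺ ∘ All.map λ { (σ , e , pw) → σ , e , pu ∷ pw }

scale-SignedG : ∀ {q X} → IsSign q → All SignedG X → All SignedG (scale q 0 X)
scale-SignedG σq = map⁺ ∘ All.map λ { (σ , e , pw) → IsSign-* σq σ , e , pw }

reverseTerm-SignedG : ∀ {X} → All SignedG X → All SignedG (map reverseTerm X)
reverseTerm-SignedG = map⁺ ∘ All.map λ { (σ , e , pw) → σ , e , All-reverse pw }

word-∗ħ-ψ*-SignedG : ∀ {x y} → All Positive x → All Positive y → All SignedG (word x ∗ħ ψ* (word y))
word-∗ħ-ψ*-SignedG {x} {y} px py =
  subst (All SignedG) (sym (word-∗ħ-ψ* x y))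
    (scale-SignedG (IsSign-signW y) (reverseTerm-SignedG (starRev-SignedG (All-reverse px) py)))

wSW-SignedG : ∀ {ws} → All Positive ws → All SignedG (wSW ws)
wSW-SignedG {ws} pws =
  subst (All SignedG) (sym (wSW-splits ws))
    (concat⁺ (map⁺ (All.map (uncurry word-∗ħ-ψ*-SignedG) (splits-All [] pws))))

index : ALetter → ℕ
index hb = 0
index (g k) = k

toZ : Term → ℤ × List ℕ
toZ (q , _ , u) = ↥ q , map index u

map-g-index : ∀ {u} → All Positive u → map g (map index u) ≡ u
map-g-index [] = refl
map-g-index (g-suc k ∷ pu) = cong (g (suc k) ∷_) (map-g-index pu)

ι-toZ : ∀ {q u} → IsSign q → All Positive u → ι (scale (↥ q / 1) 0 (gIdx (map index u))) ≡ ι ((q , 0 , u) ∷ [])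
ι-toZ sign⁺ pu = cong (λ v → ι ((1ℚ , 0 , v) ∷ [])) (map-g-index pu)
ι-toZ sign⁻ pu = cong (λ v → ι ((- 1ℚ , 0 , v) ∷ [])) (map-g-index pu)

zComb-toZ : ∀ {X} → All SignedG X → zComb (map toZ X) ≡ ι X
zComb-toZ [] = refl
zComb-toZ {(q , n , u) ∷ X} ((σ , refl , pu) ∷ ps) = cong₂ _++_ (ι-toZ σ pu) (zComb-toZ ps)

Admissible-∷ : ∀ {k k′ ks} → 1 ≤ k → Admissible (k′ ∷ ks) → Admissible (k ∷ k′ ∷ ks)
Admissible-∷ {k′ = k′} {ks} 1≤k adm with last (k′ ∷ ks)
... | nothing = 1≤k ∷ adm
... | just _ = (1≤k ∷ proj₁ adm) , proj₂ adm

Admissible-index : ∀ {u} → All Positive u → T (not (endsInG1 u)) → Admissible (map index u)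
Admissible-index [] _ = []
Admissible-index (g-suc (suc k) ∷ []) _ = (s≤s z≤n ∷ []) , s≤s (s≤s z≤n)
Admissible-index (g-suc k ∷ p ∷ ps) ¬ends = Admissible-∷ (s≤s z≤n) (Admissible-index (p ∷ ps) ¬ends)

notEndingInG1-Admissible : ∀ {X} → All SignedG X → All (λ c → Admissible (proj₂ c)) (map toZ (notEndingInG1 X))
notEndingInG1-Admissible [] = []
notEndingInG1-Admissible {(q , n , u) ∷ X} ((_ , _ , pu) ∷ ps) with endsInG1 u | Admissible-index pu
... | true | _ = notEndingInG1-Admissible ps
... | false | adm = adm tt ∷ notEndingInG1-Admissible ps

wS-word : ∀ w → wS (word w) ≡ wSW w
wS-word w = trans (++-identityʳ (scale 1ℚ 0 (wSW w))) (scale-1 (wSW w))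
  where
  scale-1 : ∀ X → scale 1ℚ 0 X ≡ X
  scale-1 [] = refl
  scale-1 ((q , n , u) ∷ X) = cong₂ _∷_ (cong (_, n , u) (ℚ.*-identityˡ q)) (scale-1 X)

IsIndex-Positive : ∀ {ks} → IsIndex ks → All Positive (map g ks)
IsIndex-Positive [] = []
IsIndex-Positive (s≤s {n = k} z≤n ∷ ks-index) = g-suc k ∷ IsIndex-Positive ks-index

proposition5p1 : (ks : List ℕ) → IsIndex ks →
    Σ (List (ℤ × List ℕ)) λ cs →
      All (λ p → Admissible (proj₂ p)) cs × (ι (wS (gIdx ks)) ≈H zComb cs)
proposition5p1 ks ks-index =
  map toZ (notEndingInG1 W) , notEndingInG1-Admissible W-signed , coefficients
  where
  W = wSW (map g ks)
  positive : All Positive (map g ks)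
  positive = IsIndex-Positive ks-index
  W-signed : All SignedG W
  W-signed = wSW-SignedG positive
  signed-rest : All SignedG (notEndingInG1 W)
  signed-rest = filter⁺ (T? ∘ not ∘ endsInG1 ∘ wordOf) W-signed
  coefficients : ι (wS (gIdx ks)) ≈H zComb (map toZ (notEndingInG1 W))
  coefficients n w = begin
    coeff (ι (wS (gIdx ks))) n w           ≡⟨ cong φ (wS-word (map g ks)) ⟩
    φ W                                    ≡⟨ φ-partition (endsInG1 ∘ wordOf) W ⟩
    φ (endingInG1 W) + φ (notEndingInG1 W) ≡⟨ cong (_+ φ (notEndingInG1 W)) (endingInG1-vanishes positive) ⟩
    0ℚ + φ (notEndingInG1 W)               ≡⟨ ℚ.+-identityˡ _ ⟩
    φ (notEndingInG1 W)                    ≡⟨ cong (λ Z → coeff Z n w) (sym (zComb-toZ signed-rest)) ⟩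
    coeff (zComb (map toZ (notEndingInG1 W))) n w ∎
    where open AtMonomial n w
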